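{- Let $G_1=(V_1,E_1)$ and $G_2=(V_2,E_2)$ be connected graphs with disjoint vertex sets, let $v_1\in V_1$, $v_2\in V_2$, and let $G=(V_1\cup V_2,\,E_1\cup E_2\cup\{(v_1,v_2)\})$. \begin{enumerate} \item[(a)] If $\beta_{G_1}(v_1)\ne1$ and $\beta_{G_2}(v_2)\ne1$, then $\partial G=\partial G_1\cup\partial G_2$. \item[(b)] If $\beta_{G_1}(v_1)=1$ and $\beta_{G_2}(v_2)\ne1$, then $\partial G=(\partial G_1\cup\partial G_2)\setminus\{v_1\}$. \item[(c)] If $\beta_{G_1}(v_1)\ne1$ and $\beta_{G_2}(v_2)=1$, then $\partial G=(\partial G_1\cup\partial G_2)\setminus\{v_2\}$. \item[(d)] If $\beta_{G_1}(v_1)=1$ and $\beta_{G_2}(v_2)=1$, then $\partial G=(\partial G_1\cup\partial G_2)\setminus\{v_1,v_2\}$. \end{enumerate} In particular, $|\partial G|\ge\max\{|\partial G_1|,|\partial G_2|\}$.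
   Context: Graphs are finite, simple, undirected; $d_H$ and $N_H$ denote distance and neighbourhood in a graph $H$. For a connected graph $H=(V,E)$, the Steinerberger boundary is $\partial H=\{v\in V:\ \exists u\in V \text{ with } \frac{1}{\deg_H(v)}\sum_{w\in N_H(v)} d_H(w,u)<d_H(v,u)\}$, with the convention $\partial H=V$ if $|V|=1$. For $v,u\in V$, $\beta_H(v,u)=\sum_{w\in N_H(v)}[d_H(v,u)-d_H(w,u)]$ and $\beta_H(v)=\max_{u\in V}\beta_H(v,u)$ (so $\beta_H(v)=0$ for the one-vertex graph). -}

module Defs where

open import Data.Nat as ℕ using (ℕ; zero; suc; _+_; _*_; _<ᵇ_; _≡ᵇ_)
open import Data.Integer as ℤ using (ℤ; _-_; _⊔_)
open import Data.Fin as Fin using (Fin; _↑ˡ_; _↑ʳ_; splitAt)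
open import Data.Fin.Subset using (Subset; ⊥)
open import Data.Bool using (Bool; true; false; _∧_; _∨_; not; if_then_else_)
open import Data.List using (List; foldr; map; allFin)
open import Data.Nat.ListAction using (sum)
open import Data.Bool.ListAction using (any)
open import Data.Vec using (tabulate; _++_)
open import Data.Sum using (_⊎_; inj₁; inj₂)
open import Data.Product using (∃)
open import Relation.Binary.PropositionalEquality using (_≡_; refl)

record Graph : Set where
  field
    size   : ℕ
    adj    : Fin size → Fin size → Bool
    sym    : ∀ u v → adj u v ≡ adj v u
    irrefl : ∀ v → adj v v ≡ false
open Graph public

V : Graph → Set
V H = Fin (size H)

reach : (H : Graph) → ℕ → V H → V H → Bool
reach H zero    u v = Fin.toℕ u ≡ᵇ Fin.toℕ v
reach H (suc k) u v =
  reach H k u v ∨ any (λ w → adj H u w ∧ reach H k w v) (allFin (size H))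

Connected : Graph → Set
Connected H = ∀ (u v : V H) → ∃ λ k → reach H k u v ≡ true

-- least k ≤ bound with reach H k u v (returns bound+1 if none).
private
  search : (H : Graph) → V H → V H → ℕ → ℕ → ℕ
  search H u v k zero    = if reach H k u v then k else suc k
  search H u v k (suc b) = if reach H k u v then k else search H u v (suc k) b

-- In a connected graph
-- with n vertices this is < n, so searching k = 0 … n suffices.
dist : (H : Graph) → V H → V H → ℕ
dist H u v = search H u v 0 (size H)

sumN : (H : Graph) → V H → (V H → ℕ) → ℕ
sumN H v f = sum (map (λ w → if adj H v w then f w else 0) (allFin (size H)))

sumNℤ : (H : Graph) → V H → (V H → ℤ) → ℤ
sumNℤ H v f = foldr ℤ._+_ (ℤ.+ 0)
  (map (λ w → if adj H v w then f w else ℤ.+ 0) (allFin (size H)))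

deg : (H : Graph) → V H → ℕ
deg H v = sumN H v (λ _ → 1)

-- The Steinerberger condition (1/deg v) Σ_{w∈N(v)} d(w,u) < d(v,u),
-- with the denominator cleared: Σ_{w∈N(v)} d(w,u) < deg(v) · d(v,u).
-- Convention: every vertex is a boundary vertex when |V| = 1.
isBoundary : (H : Graph) → V H → Bool
isBoundary H v =
  (size H ≡ᵇ 1) ∨
  any (λ u → sumN H v (λ w → dist H w u) <ᵇ deg H v * dist H v u)
      (allFin (size H))

∂ : (H : Graph) → Subset (size H)
∂ H = tabulate (isBoundary H)

βpair : (H : Graph) → V H → V H → ℤ
βpair H v u = sumNℤ H v (λ w → ℤ.+ dist H v u - ℤ.+ dist H w u)

-- β_H(v) = max_{u ∈ V} β_H(v,u)  (the fold is seeded with the value at u = v,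
-- which is itself one of the maximised values)
β : (H : Graph) → V H → ℤ
β H v = foldr _⊔_ (βpair H v v) (map (βpair H v) (allFin (size H)))

-- The graph G obtained from disjoint G₁, G₂ (vertex set Fin n₁ + Fin n₂,
-- V₁ embedded via _↑ˡ_, V₂ via _↑ʳ_) by adding the single edge v₁v₂.
eqF : ∀ {n} → Fin n → Fin n → Bool
eqF a b = Fin.toℕ a ≡ᵇ Fin.toℕ b

joinAdj′ : (G₁ G₂ : Graph) → V G₁ → V G₂ →
           V G₁ ⊎ V G₂ → V G₁ ⊎ V G₂ → Bool
joinAdj′ G₁ G₂ v₁ v₂ (inj₁ a) (inj₁ b) = adj G₁ a b
joinAdj′ G₁ G₂ v₁ v₂ (inj₂ a) (inj₂ b) = adj G₂ a b
joinAdj′ G₁ G₂ v₁ v₂ (inj₁ a) (inj₂ b) = eqF a v₁ ∧ eqF b v₂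
joinAdj′ G₁ G₂ v₁ v₂ (inj₂ a) (inj₁ b) = eqF b v₁ ∧ eqF a v₂

joinAdj′-sym : ∀ G₁ G₂ v₁ v₂ x y →
  joinAdj′ G₁ G₂ v₁ v₂ x y ≡ joinAdj′ G₁ G₂ v₁ v₂ y x
joinAdj′-sym G₁ G₂ v₁ v₂ (inj₁ a) (inj₁ b) = sym G₁ a b
joinAdj′-sym G₁ G₂ v₁ v₂ (inj₂ a) (inj₂ b) = sym G₂ a b
joinAdj′-sym G₁ G₂ v₁ v₂ (inj₁ a) (inj₂ b) = refl
joinAdj′-sym G₁ G₂ v₁ v₂ (inj₂ a) (inj₁ b) = refl

joinAdj′-irr : ∀ G₁ G₂ v₁ v₂ x → joinAdj′ G₁ G₂ v₁ v₂ x x ≡ false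
joinAdj′-irr G₁ G₂ v₁ v₂ (inj₁ a) = irrefl G₁ a
joinAdj′-irr G₁ G₂ v₁ v₂ (inj₂ a) = irrefl G₂ a

join : (G₁ G₂ : Graph) → V G₁ → V G₂ → Graph
join G₁ G₂ v₁ v₂ = record
  { size   = size G₁ + size G₂
  ; adj    = λ i j → joinAdj′ G₁ G₂ v₁ v₂ (splitAt (size G₁) i) (splitAt (size G₁) j)
  ; sym    = λ i j → joinAdj′-sym G₁ G₂ v₁ v₂ (splitAt (size G₁) i) (splitAt (size G₁) j)
  ; irrefl = λ i → joinAdj′-irr G₁ G₂ v₁ v₂ (splitAt (size G₁) i)
  }

embedˡ : ∀ {n₁} n₂ → Subset n₁ → Subset (n₁ + n₂)
embedˡ n₂ S = S ++ ⊥

embedʳ : ∀ n₁ {n₂} → Subset n₂ → Subset (n₁ + n₂)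
embedʳ n₁ S = ⊥ {n₁} ++ S

{-# OPTIONS --safe #-}
-- Distances in the joined graph G are those of G₁ and G₂, together with
-- d(x,v₁) + 1 + d(v₂,y) across the new edge.  Consequently, for x ≠ v₁ in G₁, the boundary
-- condition at x towards any target is the same in G as in G₁ (towards a target in G₂ it
-- is the condition towards v₁).  At v₁ the new neighbour v₂ adds 1 + d(v₁,u) to the
-- neighbour sum and d(v₁,u) to deg·d(v₁,u), so towards u ∈ G₁ the condition becomes
-- β(v₁,u) ≥ 2, while towards G₂ it holds only when v₁ is isolated.  Hence v₁ ∈ ∂G iff
-- |G₁| = 1 or β(v₁) ≥ 2, whereas v₁ ∈ ∂G₁ iff |G₁| = 1 or β(v₁) ≥ 1: the two differ
-- exactly when β(v₁) = 1.  For the cardinality, each half of ∂G misses at most one vertex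
-- of ∂Gᵢ and contains a vertex farthest from the attachment point.
module Submission where

open import Defs
open import Data.Nat using (_≤_; _⊔_)
open import Data.Integer using (ℤ; +_)
open import Data.Fin using (_↑ˡ_; _↑ʳ_)
open import Data.Fin.Subset using (_∪_; _─_; ⁅_⁆; ∣_∣)
open import Data.Product using (_×_)
open import Relation.Binary.PropositionalEquality using (_≡_; _≢_)

open import Data.Nat using (ℕ; zero; suc; _+_; _*_; _∸_; _<_; _<ᵇ_; z≤n; s≤s; s≤s⁻¹)
import Data.Nat.Properties as ℕ
import Data.Integer as ℤ
import Data.Integer.Properties as ℤₚ
open import Data.Fin using (Fin; zero; suc; toℕ)
import Data.Fin.Properties as Fin
open import Data.Fin.Subset using (Subset; ⊥; _∈_)
import Data.Fin.Subset.Properties as Subset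
open import Data.Bool using (Bool; true; false; T; _∧_; _∨_; not; if_then_else_)
import Data.Bool.Properties as Bool
open import Data.List using ([]; _∷_; map; allFin; foldr)
import Data.List.Properties as List
open import Data.List.Membership.Propositional using (lose)
open import Data.List.Membership.Propositional.Properties using (∈-allFin; ∈-map⁺; ∈-map⁻; foldr-selective)
open import Data.List.Relation.Unary.Any using (satisfied)
open import Data.List.Relation.Unary.Any.Properties using (any⁺; any⁻)
open import Data.List.Properties using (foldr-forcesᵇ)
import Data.List.Relation.Unary.All as All
open import Data.List.Extrema.Nat using (argmax; f[xs]≤f[argmax])
open import Data.Nat.ListAction using (sum)
open import Data.Bool.ListAction using (any; or)
open import Data.Vec using ([]; _∷_; tabulate; _++_)
import Data.Vec.Properties as Vec
open import Data.Product using (∃; _,_; proj₁; proj₂)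
open import Data.Sum using (_⊎_; inj₁; inj₂)
import Data.Sum as Sum
open import Data.Empty using (⊥-elim)
open import Data.Unit using (tt)
open import Function using (_∘_; id; _⇔_; mk⇔; Equivalence)
open import Relation.Nullary using (yes; no; ¬_; contradiction)
open import Relation.Binary.PropositionalEquality
  using (refl; trans; cong; cong₂; subst; subst₂; module ≡-Reasoning)
import Relation.Binary.PropositionalEquality as ≡

open import Algebra.Properties.CommutativeSemigroup ℕ.+-commutativeSemigroup
  using () renaming (interchange to +-interchange; xy∙z≈xz∙y to +-right-comm)

open Equivalence using (to; from)
import Function.Properties.Equivalence as ⇔
open import Data.Integer.Solver using (module +-*-Solver)
open +-*-Solver using (_:+_; _:-_; _:=_) renaming (solve to ℤ-solve)
open import Algebra.Bundles using (AbelianGroup)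
open import Algebra.Properties.Group (AbelianGroup.group ℤₚ.+-0-abelianGroup)
  using (//-rightDividesˡ; //-rightDividesʳ)

T-ext : ∀ {b c : Bool} → (T b → T c) → (T c → T b) → b ≡ c
T-ext {false} {false} _ _ = refl
T-ext {false} {true}  _ g = ⊥-elim (g tt)
T-ext {true}  {false} f _ = ⊥-elim (f tt)
T-ext {true}  {true}  _ _ = refl

if-true : ∀ {A : Set} {b} {x y : A} → T b → (if b then x else y) ≡ x
if-true {b = true} _ = refl

≡⇒T⇔ : ∀ {b c} → b ≡ c → T b ⇔ T c
≡⇒T⇔ b≡c = mk⇔ (subst T b≡c) (subst T (≡.sym b≡c))

T-<ᵇ⇔ : ∀ m n → T (m <ᵇ n) ⇔ m < n
T-<ᵇ⇔ m n = mk⇔ (ℕ.<ᵇ⇒< m n) ℕ.<⇒<ᵇ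

<ᵇ-cancelʳ : ∀ k m n → (m + k <ᵇ n + k) ≡ (m <ᵇ n)
<ᵇ-cancelʳ k m n = T-ext (ℕ.<⇒<ᵇ ∘ ℕ.+-cancelʳ-< k m n ∘ ℕ.<ᵇ⇒< (m + k) (n + k))
                         (ℕ.<⇒<ᵇ ∘ ℕ.+-monoˡ-< k {m} {n} ∘ ℕ.<ᵇ⇒< m n)

indicator : Bool → ℕ
indicator b = if b then 1 else 0

indicator≤1 : ∀ b → indicator b ≤ 1
indicator≤1 false = z≤n
indicator≤1 true  = ℕ.≤-refl

indicator-mono-≤ : ∀ {b c} → (T b → T c) → indicator b ≤ indicator c
indicator-mono-≤ {false} _   = z≤n
indicator-mono-≤ {true}  {true}  _   = ℕ.≤-refl
indicator-mono-≤ {true}  {false} b⇒c = ⊥-elim (b⇒c tt)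

indicator-mono-< : ∀ {b c} → (T b → T c) → b ≢ c → indicator b < indicator c
indicator-mono-< {false} {false} _   b≢c = contradiction refl b≢c
indicator-mono-< {false} {true}  _   _   = ℕ.≤-refl
indicator-mono-< {true}  {false} b⇒c _   = ⊥-elim (b⇒c tt)
indicator-mono-< {true}  {true}  _   b≢c = contradiction refl b≢c

eqF-refl : ∀ {n} (a : Fin n) → eqF a a ≡ true
eqF-refl a = to Bool.T-≡ (ℕ.≡⇒≡ᵇ (toℕ a) (toℕ a) refl)

T-eqF⇒≡ : ∀ {n} {a b : Fin n} → T (eqF a b) → a ≡ b
T-eqF⇒≡ {a = a} {b} eq = Fin.toℕ-injective (ℕ.≡ᵇ⇒≡ (toℕ a) (toℕ b) eq)

¬T⇒≡false : ∀ {b} → ¬ T b → b ≡ false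
¬T⇒≡false {false} _  = refl
¬T⇒≡false {true}  ¬t = ⊥-elim (¬t tt)

eqF-≢ : ∀ {n} {a b : Fin n} → a ≢ b → eqF a b ≡ false
eqF-≢ a≢b = ¬T⇒≡false (a≢b ∘ T-eqF⇒≡)

sumFin : (n : ℕ) → (Fin n → ℕ) → ℕ
sumFin n h = sum (map h (allFin n))

map-allFin-suc : ∀ {A : Set} n (h : Fin (suc n) → A) →
  map h (allFin (suc n)) ≡ h zero ∷ map (h ∘ suc) (allFin n)
map-allFin-suc n h =
  cong (h zero ∷_) (trans (List.map-tabulate suc h) (≡.sym (List.map-tabulate id (h ∘ suc))))

sumFin-suc : ∀ n (h : Fin (suc n) → ℕ) → sumFin (suc n) h ≡ h zero + sumFin n (h ∘ suc)
sumFin-suc n h = cong sum (map-allFin-suc n h)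

sumFin-cong : ∀ n {h k : Fin n → ℕ} → (∀ i → h i ≡ k i) → sumFin n h ≡ sumFin n k
sumFin-cong n h≗k = cong sum (List.map-cong h≗k (allFin n))

sumFin-mono-≤ : ∀ n {h k : Fin n → ℕ} → (∀ i → h i ≤ k i) → sumFin n h ≤ sumFin n k
sumFin-mono-≤ zero    h≤k = z≤n
sumFin-mono-≤ (suc n) {h} {k} h≤k rewrite sumFin-suc n h | sumFin-suc n k =
  ℕ.+-mono-≤ (h≤k zero) (sumFin-mono-≤ n (h≤k ∘ suc))

sumFin-mono-< : ∀ n {h k : Fin n → ℕ} → (∀ i → h i ≤ k i) → ∀ j → h j < k j →
  sumFin n h < sumFin n k
sumFin-mono-< (suc n) {h} {k} h≤k zero h<k rewrite sumFin-suc n h | sumFin-suc n k =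
  ℕ.+-mono-<-≤ h<k (sumFin-mono-≤ n (h≤k ∘ suc))
sumFin-mono-< (suc n) {h} {k} h≤k (suc j) h<k rewrite sumFin-suc n h | sumFin-suc n k =
  ℕ.+-mono-≤-< (h≤k zero) (sumFin-mono-< n (h≤k ∘ suc) j h<k)

term≤sumFin : ∀ n (h : Fin n → ℕ) i → h i ≤ sumFin n h
term≤sumFin (suc n) h zero    rewrite sumFin-suc n h = ℕ.m≤m+n (h zero) _
term≤sumFin (suc n) h (suc i) rewrite sumFin-suc n h =
  ℕ.≤-trans (term≤sumFin n (h ∘ suc) i) (ℕ.m≤n+m _ (h zero))

sumFin-+ : ∀ n (h k : Fin n → ℕ) → sumFin n (λ i → h i + k i) ≡ sumFin n h + sumFin n k
sumFin-+ zero    h k = refl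
sumFin-+ (suc n) h k rewrite sumFin-suc n (λ i → h i + k i) | sumFin-suc n h | sumFin-suc n k
  | sumFin-+ n (h ∘ suc) (k ∘ suc) = +-interchange (h zero) (k zero) _ _

sumFin-*ʳ : ∀ n (h : Fin n → ℕ) c → sumFin n (λ i → h i * c) ≡ sumFin n h * c
sumFin-*ʳ zero    h c = refl
sumFin-*ʳ (suc n) h c rewrite sumFin-suc n (λ i → h i * c) | sumFin-suc n h
  | sumFin-*ʳ n (h ∘ suc) c = ≡.sym (ℕ.*-distribʳ-+ c (h zero) _)

sumFin-zero : ∀ n {h : Fin n → ℕ} → (∀ i → h i ≡ 0) → sumFin n h ≡ 0
sumFin-zero zero    h≡0 = refl
sumFin-zero (suc n) {h} h≡0 rewrite sumFin-suc n h | h≡0 zero = sumFin-zero n (h≡0 ∘ suc)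

sumFin-one : ∀ n → sumFin n (λ _ → 1) ≡ n
sumFin-one zero    = refl
sumFin-one (suc n) = trans (sumFin-suc n (λ _ → 1)) (cong suc (sumFin-one n))

sumFin-↑ : ∀ m n (h : Fin (m + n) → ℕ) →
  sumFin (m + n) h ≡ sumFin m (λ i → h (i ↑ˡ n)) + sumFin n (λ j → h (m ↑ʳ j))
sumFin-↑ zero    n h = refl
sumFin-↑ (suc m) n h rewrite sumFin-suc (m + n) h | sumFin-suc m (λ i → h (i ↑ˡ n))
  | sumFin-↑ m n (h ∘ suc) = ≡.sym (ℕ.+-assoc (h zero) _ _)

sumFin-point : ∀ n (b : Fin n) (g : Fin n → ℕ) → sumFin n (λ w → if eqF w b then g w else 0) ≡ g b
sumFin-point (suc n) zero    g = trans (sumFin-suc n (λ w → if eqF w zero then g w else 0))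
  (trans (cong (_+_ (g zero)) (sumFin-zero n (λ _ → refl))) (ℕ.+-identityʳ (g zero)))
sumFin-point (suc n) (suc b) g = trans (sumFin-suc n (λ w → if eqF w (suc b) then g w else 0))
  (sumFin-point n b (g ∘ suc))

anyFin⁺ : ∀ n (p : Fin n → Bool) i → T (p i) → T (any p (allFin n))
anyFin⁺ n p i pi = any⁺ p (lose (∈-allFin i) pi)

anyFin⁻ : ∀ n (p : Fin n → Bool) → T (any p (allFin n)) → ∃ λ i → T (p i)
anyFin⁻ n p = satisfied ∘ any⁻ p (allFin n)

anyFin-cong : ∀ n {p q : Fin n → Bool} → (∀ i → p i ≡ q i) → any p (allFin n) ≡ any q (allFin n)
anyFin-cong n p≗q = cong or (List.map-cong p≗q (allFin n))

reach-suc⁺ : ∀ H k u v → T (reach H k u v) ⊎ (∃ λ w → T (adj H u w) × T (reach H k w v)) →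
  T (reach H (suc k) u v)
reach-suc⁺ H k u v (inj₁ r)            = from Bool.T-∨ (inj₁ r)
reach-suc⁺ H k u v (inj₂ (w , uw , r)) =
  from Bool.T-∨ (inj₂ (anyFin⁺ (size H) _ w (from Bool.T-∧ (uw , r))))

reach-suc⁻ : ∀ H k u v → T (reach H (suc k) u v) →
  T (reach H k u v) ⊎ (∃ λ w → T (adj H u w) × T (reach H k w v))
reach-suc⁻ H k u v r with to Bool.T-∨ r
... | inj₁ r′ = inj₁ r′
... | inj₂ r′ with anyFin⁻ (size H) _ r′
...   | w , uw∧r = inj₂ (w , to Bool.T-∧ uw∧r)

reach-+ : ∀ H k u v d → T (reach H k u v) → T (reach H (d + k) u v)
reach-+ H k u v zero    r = r
reach-+ H k u v (suc d) r = reach-suc⁺ H (d + k) u v (inj₁ (reach-+ H k u v d r))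

reach-mono : ∀ H {k m} u v → k ≤ m → T (reach H k u v) → T (reach H m u v)
reach-mono H {k} {m} u v k≤m r =
  subst (λ i → T (reach H i u v)) (ℕ.m∸n+n≡m k≤m) (reach-+ H k u v (m ∸ k) r)

-- The balls {u | reach H k u v} increase with k and, once two consecutive ones agree, stay
-- constant; as their sizes lie between 1 and size H, they are constant from size H on.
module Stabilisation (H : Graph) (v : V H) where

  ball : ℕ → V H → Bool
  ball k u = reach H k u v

  Stable : ℕ → Set
  Stable k = ∀ u → ball (suc k) u ≡ ball k u

  ball-suc-cong : ∀ k l → (∀ u → ball k u ≡ ball l u) → ∀ u → ball (suc k) u ≡ ball (suc l) u
  ball-suc-cong k l k≗l u =
    cong₂ _∨_ (k≗l u) (anyFin-cong (size H) (λ w → cong (adj H u w ∧_) (k≗l w)))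

  stable-+ : ∀ {j} → Stable j → ∀ d u → ball (d + j) u ≡ ball j u
  stable-+     st zero    u = refl
  stable-+ {j} st (suc d) u = trans (ball-suc-cong (d + j) j (stable-+ st d) u) (st u)

  stable-≤ : ∀ {j m} → Stable j → j ≤ m → ∀ u → ball m u ≡ ball j u
  stable-≤ {j} {m} st j≤m u = subst (λ i → ball i u ≡ ball j u) (ℕ.m∸n+n≡m j≤m) (stable-+ st (m ∸ j) u)

  volume : ℕ → ℕ
  volume k = sumFin (size H) (indicator ∘ ball k)

  volume≤size : ∀ k → volume k ≤ size H
  volume≤size k =
    subst (volume k ≤_) (sumFin-one (size H)) (sumFin-mono-≤ (size H) (indicator≤1 ∘ ball k))

  ball-suc : ∀ k u → T (ball k u) → T (ball (suc k) u)
  ball-suc k u r = reach-suc⁺ H k u v (inj₁ r)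

  volume-< : ∀ k → ¬ Stable k → volume k < volume (suc k)
  volume-< k unstable with Fin.¬∀⟶∃¬ (size H) _ (λ u → ball (suc k) u Bool.≟ ball k u) unstable
  ... | u , grows = sumFin-mono-< (size H) (λ w → indicator-mono-≤ (ball-suc k w)) u
                      (indicator-mono-< (ball-suc k u) (grows ∘ ≡.sym))

  stable-or-large : ∀ k → (∃ λ j → j ≤ k × Stable j) ⊎ suc k ≤ volume k
  stable-or-large zero =
    inj₂ (subst (_≤ volume 0) (cong indicator (eqF-refl v)) (term≤sumFin (size H) _ v))
  stable-or-large (suc k) with stable-or-large k
  ... | inj₁ (j , j≤k , st) = inj₁ (j , ℕ.m≤n⇒m≤1+n j≤k , st)
  ... | inj₂ large with Fin.all? (λ u → ball (suc k) u Bool.≟ ball k u)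
  ...   | yes st      = inj₁ (k , ℕ.n≤1+n k , st)
  ...   | no unstable = inj₂ (ℕ.≤-trans (s≤s large) (volume-< k unstable))

  stable-by-size : ∃ λ j → j ≤ size H × Stable j
  stable-by-size with stable-or-large (size H)
  ... | inj₁ found = found
  ... | inj₂ large = ⊥-elim (ℕ.<-irrefl refl (ℕ.≤-trans large (volume≤size (size H))))

reach-size : ∀ H k u v → T (reach H k u v) → T (reach H (size H) u v)
reach-size H k u v r with ℕ.≤-total k (size H)
... | inj₁ k≤n = reach-mono H u v k≤n r
... | inj₂ n≤k with Stabilisation.stable-by-size H v
...   | j , j≤n , st = subst T (trans (stable-≤ st (ℕ.≤-trans j≤n n≤k) u) (≡.sym (stable-≤ st j≤n u))) r
  where open Stabilisation H v using (stable-≤)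

record IsLinearSearch (p : ℕ → Bool) (f : ℕ → ℕ → ℕ) : Set where
  field
    search-zero : ∀ k → f k 0 ≡ (if p k then k else suc k)
    search-suc  : ∀ k b → f k (suc b) ≡ (if p k then k else f (suc k) b)

linearSearch-least : ∀ {p f} → IsLinearSearch p f → ∀ k b j → k ≤ j → j ≤ b + k → T (p j) →
  f k b ≤ j × T (p (f k b))
linearSearch-least {p} search k zero j k≤j j≤k pj
  rewrite IsLinearSearch.search-zero search k with p k in pk
... | true  = k≤j , subst T (≡.sym pk) tt
... | false = ⊥-elim (subst T pk (subst (T ∘ p) (ℕ.≤-antisym j≤k k≤j) pj))
linearSearch-least {p} search k (suc b) j k≤j j≤1+b+k pj
  rewrite IsLinearSearch.search-suc search k b with p k in pk
... | true  = k≤j , subst T (≡.sym pk) tt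
... | false = linearSearch-least search (suc k) b j k<j (subst (j ≤_) (≡.sym (ℕ.+-suc b k)) j≤1+b+k) pj
  where
  k<j : k < j
  k<j = ℕ.≤∧≢⇒< k≤j (λ k≡j → subst T pk (subst (T ∘ p) (≡.sym k≡j) pj))

-- The search defining dist is private; generalising its arguments 0 and size H with
-- `with` lets unification recover it from the goal.
dist-least : ∀ H u v j → j ≤ size H → T (reach H j u v) →
  dist H u v ≤ j × T (reach H (dist H u v) u v)
dist-least H u v j j≤n = least j z≤n (subst (j ≤_) (≡.sym (ℕ.+-identityʳ (size H))) j≤n)
  where
  least : ∀ j → 0 ≤ j → j ≤ size H + 0 → T (reach H j u v) →
    dist H u v ≤ j × T (reach H (dist H u v) u v)
  least with linearSearch-least {λ k → reach H k u v}
                (record { search-zero = λ _ → refl ; search-suc = λ _ _ → refl }) | 0 | size H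
  ... | spec | k | b = spec k b

Reachable : (H : Graph) → V H → V H → Set
Reachable H u v = ∃ λ k → T (reach H k u v)

dist-≤⇔ : ∀ H {u v} → Reachable H u v → ∀ m → dist H u v ≤ m ⇔ T (reach H m u v)
dist-≤⇔ H {u} {v} (k , r) m = mk⇔ (λ d≤m → reach-mono H u v d≤m reach-dist) reach⇒dist≤
  where
  reach-n : T (reach H (size H) u v)
  reach-n = reach-size H k u v r
  reach-dist : T (reach H (dist H u v) u v)
  reach-dist = proj₂ (dist-least H u v (size H) ℕ.≤-refl reach-n)
  reach⇒dist≤ : T (reach H m u v) → dist H u v ≤ m
  reach⇒dist≤ rm with ℕ.≤-total m (size H)
  ... | inj₁ m≤n = proj₁ (dist-least H u v m m≤n rm)
  ... | inj₂ n≤m = ℕ.≤-trans (proj₁ (dist-least H u v (size H) ℕ.≤-refl reach-n)) n≤m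

dist-unique : ∀ H {u v} E → (∀ m → E ≤ m ⇔ T (reach H m u v)) → dist H u v ≡ E
dist-unique H {u} {v} E E≤⇔ = ℕ.≤-antisym (from (dist≤⇔ E) (to (E≤⇔ E) ℕ.≤-refl))
                                          (from (E≤⇔ _) (to (dist≤⇔ _) ℕ.≤-refl))
  where
  dist≤⇔ : ∀ m → dist H u v ≤ m ⇔ T (reach H m u v)
  dist≤⇔ = dist-≤⇔ H (E , to (E≤⇔ E) ℕ.≤-refl)

dist-self : ∀ H x → dist H x x ≡ 0
dist-self H x = ℕ.n≤0⇒n≡0 (from (dist-≤⇔ H (0 , reach₀) 0) reach₀)
  where
  reach₀ : T (reach H 0 x x)
  reach₀ = from Bool.T-≡ (eqF-refl x)

reachable : ∀ {H} → Connected H → ∀ u v → Reachable H u v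
reachable conn u v = proj₁ (conn u v) , from Bool.T-≡ (proj₂ (conn u v))

module Distance (A : Graph) (conn : Connected A) where

  dist-≤⇔reach : ∀ x y m → dist A x y ≤ m ⇔ T (reach A m x y)
  dist-≤⇔reach x y = dist-≤⇔ A (reachable conn x y)

  dist≡0⇒≡ : ∀ {x y} → dist A x y ≡ 0 → x ≡ y
  dist≡0⇒≡ {x} {y} d≡0 = T-eqF⇒≡ (to (dist-≤⇔reach x y 0) (ℕ.≤-reflexive d≡0))

  dist-suc⁻ : ∀ x y m → dist A x y ≤ suc m →
    dist A x y ≤ m ⊎ ∃ λ w → T (adj A x w) × dist A w y ≤ m
  dist-suc⁻ x y m d≤1+m with reach-suc⁻ A m x y (to (dist-≤⇔reach x y (suc m)) d≤1+m)
  ... | inj₁ r            = inj₁ (from (dist-≤⇔reach x y m) r)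
  ... | inj₂ (w , xw , r) = inj₂ (w , xw , from (dist-≤⇔reach w y m) r)

  closer-neighbour : ∀ {x y} → x ≢ y → ∃ λ w → T (adj A x w) × dist A w y < dist A x y
  closer-neighbour {x} {y} x≢y with dist A x y in d
  ... | zero  = ⊥-elim (x≢y (dist≡0⇒≡ d))
  ... | suc t with dist-suc⁻ x y t (ℕ.≤-reflexive d)
  ...   | inj₁ d≤t            = ⊥-elim (ℕ.<-irrefl refl (subst (_≤ t) d d≤t))
  ...   | inj₂ (w , xw , w≤t) = w , xw , s≤s w≤t

  dist-suc⁺ : ∀ x y w m → T (adj A x w) → dist A w y ≤ m → dist A x y ≤ suc m
  dist-suc⁺ x y w m xw d≤m =
    from (dist-≤⇔reach x y (suc m)) (reach-suc⁺ A m x y (inj₂ (w , xw , to (dist-≤⇔reach w y m) d≤m)))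

distSum : (H : Graph) → V H → V H → ℕ
distSum H v u = sumN H v (λ w → dist H w u)

boundaryWitness : (H : Graph) → V H → V H → Bool
boundaryWitness H v u = distSum H v u <ᵇ deg H v * dist H v u

βpair≡ : ∀ H v u → βpair H v u ≡ + (deg H v * dist H v u) ℤ.- + distSum H v u
βpair≡ H v u = sum-differences (allFin (size H))
  where
  D : ℕ
  D = dist H v u
  nbr : (V H → ℕ) → V H → ℕ
  nbr f w = if adj H v w then f w else 0
  sum-differences : ∀ ws →
    foldr ℤ._+_ (+ 0) (map (λ w → if adj H v w then + D ℤ.- + dist H w u else + 0) ws)
      ≡ + (sum (map (nbr (λ _ → 1)) ws) * D) ℤ.- + sum (map (nbr (λ w → dist H w u)) ws)
  sum-differences []       = refl
  sum-differences (w ∷ ws) with adj H v w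
  ... | true  = trans (cong (λ i → + D ℤ.- + dist H w u ℤ.+ i) (sum-differences ws))
                      (regroup (+ D) (+ dist H w u) (+ (sum (map (nbr (λ _ → 1)) ws) * D))
                               (+ sum (map (nbr (λ w → dist H w u)) ws)))
    where
    regroup : ∀ p q r s → (p ℤ.- q) ℤ.+ (r ℤ.- s) ≡ (p ℤ.+ r) ℤ.- (q ℤ.+ s)
    regroup = ℤ-solve 4 (λ p q r s → (p :- q) :+ (r :- s) := (p :+ r) :- (q :+ s)) refl
  ... | false = trans (ℤₚ.+-identityˡ _) (sum-differences ws)

+≤-⇔ : ∀ k p q → + k ℤ.≤ + p ℤ.- + q ⇔ k + q ≤ p
+≤-⇔ k p q = mk⇔
  (λ k≤p-q → ℤₚ.drop‿+≤+ (subst (+ (k + q) ℤ.≤_) (//-rightDividesˡ (+ q) (+ p)) (ℤₚ.+-monoˡ-≤ (+ q) k≤p-q)))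
  (λ k+q≤p → subst (ℤ._≤ + p ℤ.- + q) (//-rightDividesʳ (+ q) (+ k)) (ℤₚ.+-monoˡ-≤ (ℤ.- + q) (ℤ.+≤+ k+q≤p)))

+≤βpair⇔ : ∀ H v u k → + k ℤ.≤ βpair H v u ⇔ k + distSum H v u ≤ deg H v * dist H v u
+≤βpair⇔ H v u k rewrite βpair≡ H v u = +≤-⇔ k _ _

βpair≤β : ∀ H v u → βpair H v u ℤ.≤ β H v
βpair≤β H v u = All.lookup
  (foldr-forcesᵇ {P = ℤ._≤ β H v} ⊔-forces (βpair H v v) (map (βpair H v) (allFin (size H))) ℤₚ.≤-refl)
  (∈-map⁺ (βpair H v) (∈-allFin u))
  where
  ⊔-forces : ∀ i j → i ℤ.⊔ j ℤ.≤ β H v → i ℤ.≤ β H v × j ℤ.≤ β H v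
  ⊔-forces i j i⊔j≤β = ℤₚ.i⊔j≤k⇒i≤k i j i⊔j≤β , ℤₚ.i⊔j≤k⇒j≤k i j i⊔j≤β

β-attained : ∀ H v → ∃ λ u → β H v ≡ βpair H v u
β-attained H v with foldr-selective ℤₚ.⊔-sel (βpair H v v) (map (βpair H v) (allFin (size H)))
... | inj₁ β≡seed = v , β≡seed
... | inj₂ β∈values with ∈-map⁻ (βpair H v) β∈values
...   | u , _ , β≡βpair = u , β≡βpair

+≤β⇔ : ∀ H v k → + k ℤ.≤ β H v ⇔ ∃ λ u → + k ℤ.≤ βpair H v u
+≤β⇔ H v k = mk⇔ (λ k≤β → let u , β≡ = β-attained H v in u , subst (+ k ℤ.≤_) β≡ k≤β)
                 (λ (u , k≤βpair) → ℤₚ.≤-trans k≤βpair (βpair≤β H v u))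

T-boundaryWitness⇔ : ∀ H v u → T (boundaryWitness H v u) ⇔ + 1 ℤ.≤ βpair H v u
T-boundaryWitness⇔ H v u = ⇔.trans (T-<ᵇ⇔ _ _) (⇔.sym (+≤βpair⇔ H v u 1))

T-isBoundary⇔ : ∀ H v → T (isBoundary H v) ⇔ (size H ≡ 1 ⊎ + 1 ℤ.≤ β H v)
T-isBoundary⇔ H v = mk⇔ ⇒ ⇐
  where
  ⇒ : T (isBoundary H v) → size H ≡ 1 ⊎ + 1 ℤ.≤ β H v
  ⇒ b with to Bool.T-∨ b
  ... | inj₁ single = inj₁ (ℕ.≡ᵇ⇒≡ (size H) 1 single)
  ... | inj₂ witnessed with anyFin⁻ (size H) (boundaryWitness H v) witnessed
  ...   | u , w = inj₂ (from (+≤β⇔ H v 1) (u , to (T-boundaryWitness⇔ H v u) w))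
  ⇐ : size H ≡ 1 ⊎ + 1 ℤ.≤ β H v → T (isBoundary H v)
  ⇐ (inj₁ single) = from Bool.T-∨ (inj₁ (ℕ.≡⇒≡ᵇ (size H) 1 single))
  ⇐ (inj₂ 1≤β) with to (+≤β⇔ H v 1) 1≤β
  ... | u , 1≤βpair = from Bool.T-∨ (inj₂ (anyFin⁺ (size H) _ u (from (T-boundaryWitness⇔ H v u) 1≤βpair)))

T-isBoundary⇔∃witness : ∀ H v → size H ≢ 1 → T (isBoundary H v) ⇔ ∃ λ u → T (boundaryWitness H v u)
T-isBoundary⇔∃witness H v size≢1 = mk⇔ ⇒ (from Bool.T-∨ ∘ inj₂ ∘ λ (u , w) → anyFin⁺ (size H) _ u w)
  where
  ⇒ : T (isBoundary H v) → ∃ λ u → T (boundaryWitness H v u)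
  ⇒ b with to Bool.T-∨ b
  ... | inj₁ single    = contradiction (ℕ.≡ᵇ⇒≡ (size H) 1 single) size≢1
  ... | inj₂ witnessed = anyFin⁻ (size H) _ witnessed

sumN-cong : ∀ H v {f g : V H → ℕ} → (∀ w → f w ≡ g w) → sumN H v f ≡ sumN H v g
sumN-cong H v f≗g = sumFin-cong (size H) (λ w → cong (λ t → if adj H v w then t else 0) (f≗g w))

sumN-+ : ∀ H v (f g : V H → ℕ) → sumN H v (λ w → f w + g w) ≡ sumN H v f + sumN H v g
sumN-+ H v f g = trans (sumFin-cong (size H) split) (sumFin-+ (size H) _ _)
  where
  split : ∀ w → (if adj H v w then f w + g w else 0)
              ≡ (if adj H v w then f w else 0) + (if adj H v w then g w else 0)
  split w with adj H v w
  ... | true  = refl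
  ... | false = refl

sumN-const : ∀ H v c → sumN H v (λ _ → c) ≡ deg H v * c
sumN-const H v c = trans (sumFin-cong (size H) scale) (sumFin-*ʳ (size H) _ c)
  where
  scale : ∀ w → (if adj H v w then c else 0) ≡ indicator (adj H v w) * c
  scale w with adj H v w
  ... | true  = ≡.sym (ℕ.*-identityˡ c)
  ... | false = refl

sumN-isolated : ∀ H v → (∀ w → adj H v w ≡ false) → ∀ f → sumN H v f ≡ 0
sumN-isolated H v isolated f =
  sumFin-zero (size H) (λ w → cong (λ c → if c then f w else 0) (isolated w))

β-isolated : ∀ H v → (∀ w → adj H v w ≡ false) → β H v ≡ + 0
β-isolated H v isolated with β-attained H v
... | u , β≡βpair rewrite β≡βpair | βpair≡ H v u | sumN-isolated H v isolated (λ _ → 1)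
                        | sumN-isolated H v isolated (λ w → dist H w u) = refl

size≡1⇒≡ : ∀ {n} → n ≡ 1 → (x y : Fin n) → x ≡ y
size≡1⇒≡ refl zero zero = refl

all≡⇒size≡1 : ∀ {n} (a : Fin n) → (∀ y → y ≡ a) → n ≡ 1
all≡⇒size≡1 {suc zero}    a all≡a = refl
all≡⇒size≡1 {suc (suc n)} a all≡a = contradiction (trans (all≡a zero) (≡.sym (all≡a (suc zero)))) Fin.0≢1+n

module Rooted (A : Graph) (conn : Connected A) (a : V A) where
  open Distance A conn

  Isolated : Set
  Isolated = ∀ w → adj A a w ≡ false

  isolated⇔size≡1 : Isolated ⇔ size A ≡ 1
  isolated⇔size≡1 = mk⇔ (λ isolated → all≡⇒size≡1 a (λ y → let k , r = reachable conn a y in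
                                                               ≡.sym (only-a isolated y k r)))
                        (λ single w → subst (λ z → adj A a z ≡ false) (size≡1⇒≡ single a w) (irrefl A a))
    where
    only-a : Isolated → ∀ y k → T (reach A k a y) → a ≡ y
    only-a isolated y zero    r = T-eqF⇒≡ r
    only-a isolated y (suc k) r with reach-suc⁻ A k a y r
    ... | inj₁ r′           = only-a isolated y k r′
    ... | inj₂ (w , aw , _) = ⊥-elim (subst T (isolated w) aw)

  distSum≡0⇔isolated : distSum A a a ≡ 0 ⇔ Isolated
  distSum≡0⇔isolated = mk⇔ (λ sum≡0 w → ¬T⇒≡false (λ aw → ℕ.<-irrefl (≡.sym sum≡0) (far-neighbour w aw)))
                           (λ isolated → sumN-isolated A a isolated (λ w → dist A w a))
    where
    far-neighbour : ∀ w → T (adj A a w) → 0 < distSum A a a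
    far-neighbour w aw = ℕ.<-≤-trans (ℕ.n≢0⇒n>0 (λ d≡0 → w≢a (dist≡0⇒≡ d≡0)))
      (subst (_≤ distSum A a a) (if-true aw) (term≤sumFin (size A) _ w))
      where
      w≢a : w ≢ a
      w≢a refl = subst T (irrefl A w) aw

  -- A vertex x farthest from a has every neighbour at distance ≤ d(x,a) from a and one
  -- strictly closer, so a witnesses x ∈ ∂A.
  farthest-witness : ∀ x → x ≢ a → (∀ y → dist A y a ≤ dist A x a) → T (boundaryWitness A x a)
  farthest-witness x x≢a farthest with closer-neighbour x≢a
  ... | w , xw , closer = from (T-<ᵇ⇔ _ _) (begin-strict
    distSum A x a                 <⟨ sumFin-mono-< (size A) termwise w strict-at-w ⟩
    sumN A x (λ _ → dist A x a)   ≡⟨ sumN-const A x (dist A x a) ⟩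
    deg A x * dist A x a          ∎)
    where
    open ℕ.≤-Reasoning
    strict-at-w : (if adj A x w then dist A w a else 0) < (if adj A x w then dist A x a else 0)
    strict-at-w = subst₂ _<_ (≡.sym (if-true xw)) (≡.sym (if-true xw)) closer
    termwise : ∀ v → (if adj A x v then dist A v a else 0) ≤ (if adj A x v then dist A x a else 0)
    termwise v with adj A x v
    ... | true  = farthest v
    ... | false = z≤n

  witnessed-by-a : size A ≢ 1 → ∃ λ x → x ≢ a × T (boundaryWitness A x a)
  witnessed-by-a size≢1 = x , x≢a , farthest-witness x x≢a farthest
    where
    x : V A
    x = argmax (λ y → dist A y a) a (allFin (size A))
    farthest : ∀ y → dist A y a ≤ dist A x a
    farthest y = All.lookup (f[xs]≤f[argmax] a (allFin (size A))) (∈-allFin y)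
    x≢a : x ≢ a
    x≢a x≡a = size≢1 (all≡⇒size≡1 a (λ y → dist≡0⇒≡ (ℕ.n≤0⇒n≡0 (begin
      dist A y a  ≤⟨ farthest y ⟩
      dist A x a  ≡⟨ cong (λ z → dist A z a) x≡a ⟩
      dist A a a  ≡⟨ dist-self A a ⟩
      0           ∎))))
      where open ℕ.≤-Reasoning

tabulate-↑ : ∀ {A : Set} m n (f : Fin (m + n) → A) →
  tabulate f ≡ tabulate (λ i → f (i ↑ˡ n)) ++ tabulate (λ j → f (m ↑ʳ j))
tabulate-↑ zero    n f = refl
tabulate-↑ (suc m) n f = cong (f zero ∷_) (tabulate-↑ m n (f ∘ suc))

∈-tabulate⁺ : ∀ {n} (f : Fin n → Bool) {x} → T (f x) → x ∈ tabulate f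
∈-tabulate⁺ f {x} fx = Vec.lookup⇒[]= x (tabulate f) (trans (Vec.lookup∘tabulate f x) (to Bool.T-≡ fx))

∈⇒1≤∣p∣ : ∀ {n} {p : Subset n} {x} → x ∈ p → 1 ≤ ∣ p ∣
∈⇒1≤∣p∣ x∈p = ℕ.≤-trans (s≤s z≤n) (Subset.x∈p⇒∣p-x∣<∣p∣ x∈p)

∣p++q∣≡∣p∣+∣q∣ : ∀ {m n} (p : Subset m) (q : Subset n) → ∣ p ++ q ∣ ≡ ∣ p ∣ + ∣ q ∣
∣p++q∣≡∣p∣+∣q∣ []          q = refl
∣p++q∣≡∣p∣+∣q∣ (true  ∷ p) q = cong suc (∣p++q∣≡∣p∣+∣q∣ p q)
∣p++q∣≡∣p∣+∣q∣ (false ∷ p) q = ∣p++q∣≡∣p∣+∣q∣ p q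

∣p∣≤∣p─q∣+∣q∣ : ∀ {n} (p q : Subset n) → ∣ p ∣ ≤ ∣ p ─ q ∣ + ∣ q ∣
∣p∣≤∣p─q∣+∣q∣ []          []          = z≤n
∣p∣≤∣p─q∣+∣q∣ (true  ∷ p) (true  ∷ q) =
  subst (suc ∣ p ∣ ≤_) (≡.sym (ℕ.+-suc _ _)) (s≤s (∣p∣≤∣p─q∣+∣q∣ p q))
∣p∣≤∣p─q∣+∣q∣ (false ∷ p) (true  ∷ q) = ℕ.≤-trans (∣p∣≤∣p─q∣+∣q∣ p q) (ℕ.+-monoʳ-≤ _ (ℕ.n≤1+n _))
∣p∣≤∣p─q∣+∣q∣ (true  ∷ p) (false ∷ q) = s≤s (∣p∣≤∣p─q∣+∣q∣ p q)
∣p∣≤∣p─q∣+∣q∣ (false ∷ p) (false ∷ q) = ∣p∣≤∣p─q∣+∣q∣ p q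

tabulate-─-⁅⁆ : ∀ {n} (f : Fin n → Bool) j → tabulate f ─ ⁅ j ⁆ ≡ tabulate (λ i → f i ∧ not (eqF i j))
tabulate-─-⁅⁆ {suc n} f zero    = cong₂ _∷_ (≡.sym (Bool.∧-zeroʳ (f zero)))
  (trans (Subset.p─⊥≡p (tabulate (f ∘ suc)))
         (Vec.tabulate-cong (λ i → ≡.sym (Bool.∧-identityʳ (f (suc i))))))
tabulate-─-⁅⁆ {suc n} f (suc j) = cong₂ _∷_ (≡.sym (Bool.∧-identityʳ (f zero))) (tabulate-─-⁅⁆ (f ∘ suc) j)

⊥++⊥ : ∀ m n → ⊥ {m} ++ ⊥ {n} ≡ ⊥
⊥++⊥ zero    n = refl
⊥++⊥ (suc m) n = cong (false ∷_) (⊥++⊥ m n)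

⁅↑ˡ⁆ : ∀ {m} (i : Fin m) n → ⁅ i ↑ˡ n ⁆ ≡ ⁅ i ⁆ ++ ⊥ {n}
⁅↑ˡ⁆ {suc m} zero    n = cong (true ∷_) (≡.sym (⊥++⊥ m n))
⁅↑ˡ⁆         (suc i) n = cong (false ∷_) (⁅↑ˡ⁆ i n)

⁅↑ʳ⁆ : ∀ m {n} (j : Fin n) → ⁅ m ↑ʳ j ⁆ ≡ ⊥ {m} ++ ⁅ j ⁆
⁅↑ʳ⁆ zero    j = refl
⁅↑ʳ⁆ (suc m) j = cong (false ∷_) (⁅↑ʳ⁆ m j)

++⊥∪⊥++ : ∀ {m n} (p : Subset m) (q : Subset n) → (p ++ ⊥) ∪ (⊥ ++ q) ≡ p ++ q
++⊥∪⊥++ p q = trans (Vec.zipWith-++ _∨_ p ⊥ ⊥ q) (cong₂ _++_ (Subset.∪-identityʳ p) (Subset.∪-identityˡ q))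

⁅↑ˡ⁆∪⁅↑ʳ⁆ : ∀ {m n} (i : Fin m) (j : Fin n) → ⁅ i ↑ˡ n ⁆ ∪ ⁅ m ↑ʳ j ⁆ ≡ ⁅ i ⁆ ++ ⁅ j ⁆
⁅↑ˡ⁆∪⁅↑ʳ⁆ {m} {n} i j = trans (cong₂ _∪_ (⁅↑ˡ⁆ i n) (⁅↑ʳ⁆ m j)) (++⊥∪⊥++ ⁅ i ⁆ ⁅ j ⁆)

-- What ∂H loses when H is joined to another graph at v.
removed : (H : Graph) → V H → Subset (size H)
removed H v with β H v ℤ.≟ + 1
... | yes _ = ⁅ v ⁆
... | no  _ = ⊥

removed-β≡1 : ∀ H v → β H v ≡ + 1 → removed H v ≡ ⁅ v ⁆
removed-β≡1 H v β≡1 with β H v ℤ.≟ + 1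
... | yes _   = refl
... | no  β≢1 = contradiction β≡1 β≢1

removed-β≢1 : ∀ H v → β H v ≢ + 1 → removed H v ≡ ⊥
removed-β≢1 H v β≢1 with β H v ℤ.≟ + 1
... | yes β≡1 = contradiction β≡1 β≢1
... | no  _   = refl

∣removed∣≤1 : ∀ H v → ∣ removed H v ∣ ≤ 1
∣removed∣≤1 H v with β H v ℤ.≟ + 1
... | yes _ = ℕ.≤-reflexive (Subset.∣⁅x⁆∣≡1 v)
... | no  _ = ℕ.≤-trans (ℕ.≤-reflexive (Subset.∣⊥∣≡0 (size H))) z≤n

-- G is A and B joined by the single edge ι a – κ b.  Presenting the join through this
-- interface makes it symmetric (swap), so each fact is proved for the A side only.
record Join (G A B : Graph) (a : V A) (b : V B) : Set where
  field
    ι            : V A → V G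
    κ            : V B → V G
    ι-injective  : ∀ {x y} → ι x ≡ ι y → x ≡ y
    κ-injective  : ∀ {x y} → κ x ≡ κ y → x ≡ y
    ι≢κ          : ∀ x y → ι x ≢ κ y
    cover        : ∀ z → (∃ λ x → ι x ≡ z) ⊎ (∃ λ y → κ y ≡ z)
    adj-ιι       : ∀ x y → adj G (ι x) (ι y) ≡ adj A x y
    adj-κκ       : ∀ x y → adj G (κ x) (κ y) ≡ adj B x y
    adj-ικ       : ∀ x y → adj G (ι x) (κ y) ≡ (eqF x a ∧ eqF y b)
    sumFin-split : ∀ h → sumFin (size G) h ≡ sumFin (size A) (h ∘ ι) + sumFin (size B) (h ∘ κ)

swap : ∀ {G A B a b} → Join G A B a b → Join G B A b a
swap {G} {a = a} {b} J = record
  { ι            = κ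
  ; κ            = ι
  ; ι-injective  = κ-injective
  ; κ-injective  = ι-injective
  ; ι≢κ          = λ x y κx≡ιy → ι≢κ y x (≡.sym κx≡ιy)
  ; cover        = Sum.swap ∘ cover
  ; adj-ιι       = adj-κκ
  ; adj-κκ       = adj-ιι
  ; adj-ικ       = λ x y → trans (Graph.sym G (κ x) (ι y))
                                   (trans (adj-ικ y x) (Bool.∧-comm (eqF y a) (eqF x b)))
  ; sumFin-split = λ h → trans (sumFin-split h) (ℕ.+-comm (sumFin _ (h ∘ ι)) (sumFin _ (h ∘ κ)))
  }
  where open Join J

module _ {G A B : Graph} {a : V A} {b : V B} (J : Join G A B a b) where
  open Join J

  ι-neighbour : ∀ x z → T (adj G (ι x) z) →
    (∃ λ w → ι w ≡ z × T (adj A x w)) ⊎ (x ≡ a × κ b ≡ z)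
  ι-neighbour x z xz with cover z
  ... | inj₁ (w , refl) = inj₁ (w , refl , subst T (adj-ιι x w) xz)
  ... | inj₂ (w , refl) with to Bool.T-∧ (subst T (adj-ικ x w) xz)
  ...   | xa , wb with T-eqF⇒≡ {a = x} {a} xa | T-eqF⇒≡ {a = w} {b} wb
  ...     | refl | refl = inj₂ (refl , refl)

  ∃-cover⇔ : ∀ {P : V G → Set} → (∃ P) ⇔ ((∃ λ x → P (ι x)) ⊎ (∃ λ y → P (κ y)))
  ∃-cover⇔ {P} = mk⇔ split (λ { (inj₁ (x , p)) → ι x , p ; (inj₂ (y , p)) → κ y , p })
    where
    split : ∃ P → (∃ λ x → P (ι x)) ⊎ (∃ λ y → P (κ y))
    split (z , p) with cover z
    ... | inj₁ (x , refl) = inj₁ (x , p)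
    ... | inj₂ (y , refl) = inj₂ (y , p)

  ιa-κb-adjacent : T (adj G (ι a) (κ b))
  ιa-κb-adjacent = subst T (≡.sym (adj-ικ a b))
    (from Bool.T-∧ (from Bool.T-≡ (eqF-refl a) , from Bool.T-≡ (eqF-refl b)))

  DistSpec : ℕ → Set
  DistSpec m = (∀ x y → T (reach G m (ι x) (ι y)) ⇔ dist A x y ≤ m)
             × (∀ x y → T (reach G m (ι x) (κ y)) ⇔ dist A x a + suc (dist B b y) ≤ m)

  distSpec-zero : Connected A → DistSpec 0
  distSpec-zero connA = ιι , ικ
    where
    open Distance A connA
    ιι : ∀ x y → T (reach G 0 (ι x) (ι y)) ⇔ dist A x y ≤ 0
    ιι x y = mk⇔ (λ r → subst (λ z → dist A x z ≤ 0) (ι-injective (T-eqF⇒≡ r)) (ℕ.≤-reflexive (dist-self A x)))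
                 (λ d≤0 → subst (λ z → T (eqF (ι x) (ι z))) (dist≡0⇒≡ (ℕ.n≤0⇒n≡0 d≤0))
                                (from Bool.T-≡ (eqF-refl (ι x))))
    ικ : ∀ x y → T (reach G 0 (ι x) (κ y)) ⇔ dist A x a + suc (dist B b y) ≤ 0
    ικ x y = mk⇔ (λ r → ⊥-elim (ι≢κ x y (T-eqF⇒≡ r)))
                 (λ d≤0 → ⊥-elim (ℕ.n≮0 (ℕ.m+n≤o⇒n≤o (dist A x a) d≤0)))

distSpec-suc : ∀ {G A B a b} (J : Join G A B a b) → Connected A → ∀ m →
  DistSpec J m → DistSpec (swap J) m → DistSpec J (suc m)
distSpec-suc {G} {A} {B} {a} {b} J connA m (ιι , ικ) (κκ , κι) = ιι′ , ικ′
  where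
  open Join J
  open Distance A connA

  ιι′ : ∀ x y → T (reach G (suc m) (ι x) (ι y)) ⇔ dist A x y ≤ suc m
  ιι′ x y = mk⇔ reach⇒ ⇒reach
    where
    reach⇒ : T (reach G (suc m) (ι x) (ι y)) → dist A x y ≤ suc m
    reach⇒ r with reach-suc⁻ G m (ι x) (ι y) r
    ... | inj₁ r′ = ℕ.m≤n⇒m≤1+n (to (ιι x y) r′)
    ... | inj₂ (z , xz , r′) with ι-neighbour J x z xz
    ...   | inj₁ (w , refl , xw) = dist-suc⁺ x y w m xw (to (ιι w y) r′)
    ...   | inj₂ (refl , refl)   =
      ℕ.≤-trans (ℕ.n≤1+n _) (ℕ.m≤n⇒m≤1+n (ℕ.m+n≤o⇒n≤o (dist B b b) (to (κι b y) r′)))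
    ⇒reach : dist A x y ≤ suc m → T (reach G (suc m) (ι x) (ι y))
    ⇒reach d with dist-suc⁻ x y m d
    ... | inj₁ d′ = reach-suc⁺ G m (ι x) (ι y) (inj₁ (from (ιι x y) d′))
    ... | inj₂ (w , xw , d′) = reach-suc⁺ G m (ι x) (ι y)
      (inj₂ (ι w , subst T (≡.sym (adj-ιι x w)) xw , from (ιι w y) d′))

  ικ′ : ∀ x y → T (reach G (suc m) (ι x) (κ y)) ⇔ dist A x a + suc (dist B b y) ≤ suc m
  ικ′ x y = mk⇔ reach⇒ ⇒reach
    where
    c : ℕ
    c = dist B b y
    reach⇒ : T (reach G (suc m) (ι x) (κ y)) → dist A x a + suc c ≤ suc m
    reach⇒ r with reach-suc⁻ G m (ι x) (κ y) r
    ... | inj₁ r′ = ℕ.m≤n⇒m≤1+n (to (ικ x y) r′)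
    ... | inj₂ (z , xz , r′) with ι-neighbour J x z xz
    ...   | inj₁ (w , refl , xw) =
      ℕ.≤-trans (ℕ.+-monoˡ-≤ (suc c) (dist-suc⁺ x a w (dist A w a) xw ℕ.≤-refl)) (s≤s (to (ικ w y) r′))
    ...   | inj₂ (refl , refl)   =
      subst (λ t → t + suc c ≤ suc m) (≡.sym (dist-self A a)) (s≤s (to (κκ b y) r′))
    ⇒reach : dist A x a + suc c ≤ suc m → T (reach G (suc m) (ι x) (κ y))
    ⇒reach d with x Fin.≟ a
    ... | yes refl = reach-suc⁺ G m (ι x) (κ y) (inj₂ (κ b , ιa-κb-adjacent J ,
      from (κκ b y) (s≤s⁻¹ (subst (λ t → t + suc c ≤ suc m) (dist-self A a) d))))
    ... | no x≢a with closer-neighbour x≢a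
    ...   | w , xw , closer = reach-suc⁺ G m (ι x) (κ y) (inj₂ (ι w , subst T (≡.sym (adj-ιι x w)) xw ,
      from (ικ w y) (s≤s⁻¹ (ℕ.≤-trans (ℕ.+-monoˡ-≤ (suc c) closer) d))))

-- Induction on the walk length, for both sides at once since walks cross the bridge.
distSpec : ∀ {G A B a b} (J : Join G A B a b) → Connected A → Connected B → ∀ m →
  DistSpec J m × DistSpec (swap J) m
distSpec J connA connB zero = distSpec-zero J connA , distSpec-zero (swap J) connB
distSpec J connA connB (suc m) with distSpec J connA connB m
... | spec , spec′ = distSpec-suc J connA m spec spec′ , distSpec-suc (swap J) connB m spec′ spec

module JoinDistance {G A B : Graph} {a : V A} {b : V B} (J : Join G A B a b)
                    (connA : Connected A) (connB : Connected B) where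
  open Join J

  dist-ιι : ∀ x y → dist G (ι x) (ι y) ≡ dist A x y
  dist-ιι x y = dist-unique G _ (λ m → ⇔.sym (proj₁ (proj₁ (distSpec J connA connB m)) x y))

  dist-ικ : ∀ x y → dist G (ι x) (κ y) ≡ dist A x a + suc (dist B b y)
  dist-ικ x y = dist-unique G _ (λ m → ⇔.sym (proj₂ (proj₁ (distSpec J connA connB m)) x y))

module JoinBoundary {G A B : Graph} {a : V A} {b : V B} (J : Join G A B a b)
                    (connA : Connected A) (connB : Connected B) where
  open Join J
  open JoinDistance J connA connB
  open JoinDistance (swap J) connB connA using () renaming (dist-ιι to dist-κκ; dist-ικ to dist-κι)
  open Rooted A connA a

  size-G≢1 : size G ≢ 1
  size-G≢1 single = ℕ.<-irrefl refl (subst (2 ≤_) single 2≤size-G)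
    where
    1≤size : ∀ {n} → Fin n → 1 ≤ n
    1≤size i = ℕ.≤-trans (s≤s z≤n) (Fin.toℕ<n i)
    size-G : size G ≡ size A + size B
    size-G = trans (≡.sym (sumFin-one (size G)))
                   (trans (sumFin-split (λ _ → 1)) (cong₂ _+_ (sumFin-one (size A)) (sumFin-one (size B))))
    2≤size-G : 2 ≤ size G
    2≤size-G = subst (2 ≤_) (≡.sym size-G) (ℕ.+-mono-≤ (1≤size a) (1≤size b))

  sumN-ι : ∀ x f → sumN G (ι x) f ≡ sumN A x (f ∘ ι) + (if eqF x a then f (κ b) else 0)
  sumN-ι x f = trans (sumFin-split _) (cong₂ _+_
    (sumFin-cong (size A) (λ w → cong (λ c → if c then f (ι w) else 0) (adj-ιι x w)))
    (trans (sumFin-cong (size B) (λ y → cong (λ c → if c then f (κ y) else 0) (adj-ικ x y)))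
           (edge-term (eqF x a))))
    where
    edge-term : ∀ c → sumFin (size B) (λ y → if c ∧ eqF y b then f (κ y) else 0) ≡ (if c then f (κ b) else 0)
    edge-term true  = sumFin-point (size B) b (f ∘ κ)
    edge-term false = sumFin-zero (size B) (λ _ → refl)

  sumN-ι-≢ : ∀ {x} → x ≢ a → ∀ f → sumN G (ι x) f ≡ sumN A x (f ∘ ι)
  sumN-ι-≢ {x} x≢a f rewrite sumN-ι x f | eqF-≢ x≢a = ℕ.+-identityʳ _

  sumN-ιa : ∀ f → sumN G (ι a) f ≡ sumN A a (f ∘ ι) + f (κ b)
  sumN-ιa f rewrite sumN-ι a f | eqF-refl a = refl

  witness-ιι : ∀ {x} → x ≢ a → ∀ y → boundaryWitness G (ι x) (ι y) ≡ boundaryWitness A x y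
  witness-ιι {x} x≢a y = cong₂ _<ᵇ_ (trans (sumN-ι-≢ x≢a _) (sumN-cong A x (λ w → dist-ιι w y)))
                                   (cong₂ _*_ (sumN-ι-≢ x≢a _) (dist-ιι x y))

  witness-ικ : ∀ {x} → x ≢ a → ∀ y → boundaryWitness G (ι x) (κ y) ≡ boundaryWitness A x a
  witness-ικ {x} x≢a y = trans (cong₂ _<ᵇ_ distSum-ικ product-ικ)
                               (<ᵇ-cancelʳ (deg A x * c) (distSum A x a) (deg A x * dist A x a))
    where
    c : ℕ
    c = suc (dist B b y)
    distSum-ικ : distSum G (ι x) (κ y) ≡ distSum A x a + deg A x * c
    distSum-ικ = begin
      distSum G (ι x) (κ y)                   ≡⟨ sumN-ι-≢ x≢a _ ⟩
      sumN A x (λ w → dist G (ι w) (κ y))     ≡⟨ sumN-cong A x (λ w → dist-ικ w y) ⟩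
      sumN A x (λ w → dist A w a + c)         ≡⟨ sumN-+ A x (λ w → dist A w a) (λ _ → c) ⟩
      distSum A x a + sumN A x (λ _ → c)      ≡⟨ cong (_+_ (distSum A x a)) (sumN-const A x c) ⟩
      distSum A x a + deg A x * c             ∎
      where open ≡-Reasoning
    product-ικ : deg G (ι x) * dist G (ι x) (κ y) ≡ deg A x * dist A x a + deg A x * c
    product-ικ = trans (cong₂ _*_ (sumN-ι-≢ x≢a _) (dist-ικ x y)) (ℕ.*-distribˡ-+ (deg A x) (dist A x a) c)

  witness-ιa-ι : ∀ y → T (boundaryWitness G (ι a) (ι y)) ⇔ + 2 ℤ.≤ βpair A a y
  witness-ιa-ι y = ⇔.trans (≡⇒T⇔ (trans (cong₂ _<ᵇ_ distSum-ιa-ι product-ιa-ι) (<ᵇ-cancelʳ d (suc S) (D * d))))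
                           (⇔.trans (T-<ᵇ⇔ (suc S) (D * d)) (⇔.sym (+≤βpair⇔ A a y 2)))
    where
    S D d : ℕ
    S = distSum A a y
    D = deg A a
    d = dist A a y
    distSum-ιa-ι : distSum G (ι a) (ι y) ≡ suc S + d
    distSum-ιa-ι = begin
      distSum G (ι a) (ι y)                                     ≡⟨ sumN-ιa _ ⟩
      sumN A a (λ w → dist G (ι w) (ι y)) + dist G (κ b) (ι y)
        ≡⟨ cong₂ _+_ (sumN-cong A a (λ w → dist-ιι w y)) (dist-κι b y) ⟩
      S + (dist B b b + suc d)                                  ≡⟨ cong (λ t → S + (t + suc d)) (dist-self B b) ⟩
      S + suc d                                                 ≡⟨ ℕ.+-suc S d ⟩
      suc S + d                                                 ∎
      where open ≡-Reasoning
    product-ιa-ι : deg G (ι a) * dist G (ι a) (ι y) ≡ D * d + d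
    product-ιa-ι = begin
      deg G (ι a) * dist G (ι a) (ι y)  ≡⟨ cong₂ _*_ (sumN-ιa _) (dist-ιι a y) ⟩
      (D + 1) * d                       ≡⟨ ℕ.*-distribʳ-+ d D 1 ⟩
      D * d + 1 * d                     ≡⟨ cong (_+_ (D * d)) (ℕ.*-identityˡ d) ⟩
      D * d + d                         ∎
      where open ≡-Reasoning

  witness-ιa-κ : ∀ y → T (boundaryWitness G (ι a) (κ y)) ⇔ size A ≡ 1
  witness-ιa-κ y =
    ⇔.trans (≡⇒T⇔ (trans (cong₂ _<ᵇ_ distSum-ιa-κ product-ιa-κ)
                         (trans (<ᵇ-cancelʳ (D * suc c) (S₀ + c) (1 + c)) (<ᵇ-cancelʳ c S₀ 1))))
            (⇔.trans (T-<ᵇ⇔ S₀ 1) (⇔.trans <1⇔≡0 (⇔.trans distSum≡0⇔isolated isolated⇔size≡1)))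
    where
    S₀ D c : ℕ
    S₀ = distSum A a a
    D = deg A a
    c = dist B b y
    <1⇔≡0 : S₀ < 1 ⇔ S₀ ≡ 0
    <1⇔≡0 = mk⇔ (λ { (s≤s S₀≤0) → ℕ.n≤0⇒n≡0 S₀≤0 }) (λ S₀≡0 → s≤s (ℕ.≤-reflexive S₀≡0))
    distSum-ιa-κ : distSum G (ι a) (κ y) ≡ (S₀ + c) + D * suc c
    distSum-ιa-κ = begin
      distSum G (ι a) (κ y)                                     ≡⟨ sumN-ιa _ ⟩
      sumN A a (λ w → dist G (ι w) (κ y)) + dist G (κ b) (κ y)
        ≡⟨ cong₂ _+_ (sumN-cong A a (λ w → dist-ικ w y)) (dist-κκ b y) ⟩
      sumN A a (λ w → dist A w a + suc c) + c
        ≡⟨ cong (_+ c) (sumN-+ A a (λ w → dist A w a) (λ _ → suc c)) ⟩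
      (S₀ + sumN A a (λ _ → suc c)) + c
        ≡⟨ cong (λ t → (S₀ + t) + c) (sumN-const A a (suc c)) ⟩
      (S₀ + D * suc c) + c                                      ≡⟨ +-right-comm S₀ (D * suc c) c ⟩
      (S₀ + c) + D * suc c                                      ∎
      where open ≡-Reasoning
    product-ιa-κ : deg G (ι a) * dist G (ι a) (κ y) ≡ (1 + c) + D * suc c
    product-ιa-κ = begin
      deg G (ι a) * dist G (ι a) (κ y)  ≡⟨ cong₂ _*_ (sumN-ιa _) (dist-ικ a y) ⟩
      (D + 1) * (dist A a a + suc c)    ≡⟨ cong (λ t → (D + 1) * (t + suc c)) (dist-self A a) ⟩
      (D + 1) * suc c                   ≡⟨ ℕ.*-distribʳ-+ (suc c) D 1 ⟩
      D * suc c + 1 * suc c             ≡⟨ ℕ.+-comm (D * suc c) _ ⟩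
      1 * suc c + D * suc c             ≡⟨ cong (_+ D * suc c) (ℕ.*-identityˡ (suc c)) ⟩
      (1 + c) + D * suc c               ∎
      where open ≡-Reasoning

  isBoundary-ι-≢ : ∀ {x} → x ≢ a → isBoundary G (ι x) ≡ isBoundary A x
  isBoundary-ι-≢ {x} x≢a = T-ext (from inA ∘ collapse ∘ to (∃-cover⇔ J) ∘ to inG)
                                 ((λ (y , w) → from inG (ι y , subst T (≡.sym (witness-ιι x≢a y)) w)) ∘ to inA)
    where
    inG : T (isBoundary G (ι x)) ⇔ ∃ λ z → T (boundaryWitness G (ι x) z)
    inG = T-isBoundary⇔∃witness G (ι x) size-G≢1
    inA : T (isBoundary A x) ⇔ ∃ λ y → T (boundaryWitness A x y)
    inA = T-isBoundary⇔∃witness A x (λ single → x≢a (size≡1⇒≡ single x a))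
    collapse : (∃ λ y → T (boundaryWitness G (ι x) (ι y))) ⊎ (∃ λ y → T (boundaryWitness G (ι x) (κ y))) →
               ∃ λ y → T (boundaryWitness A x y)
    collapse (inj₁ (y , w)) = y , subst T (witness-ιι x≢a y) w
    collapse (inj₂ (y , w)) = a , subst T (witness-ικ x≢a y) w

  T-isBoundary-ιa⇔ : T (isBoundary G (ι a)) ⇔ (size A ≡ 1 ⊎ + 2 ℤ.≤ β A a)
  T-isBoundary-ιa⇔ = ⇔.trans (T-isBoundary⇔∃witness G (ι a) size-G≢1) (⇔.trans (∃-cover⇔ J) (mk⇔ ⇒ ⇐))
    where
    ⇒ : (∃ λ y → T (boundaryWitness G (ι a) (ι y))) ⊎ (∃ λ y → T (boundaryWitness G (ι a) (κ y))) →
        size A ≡ 1 ⊎ + 2 ℤ.≤ β A a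
    ⇒ (inj₁ (y , w)) = inj₂ (from (+≤β⇔ A a 2) (y , to (witness-ιa-ι y) w))
    ⇒ (inj₂ (y , w)) = inj₁ (to (witness-ιa-κ y) w)
    ⇐ : size A ≡ 1 ⊎ + 2 ℤ.≤ β A a →
        (∃ λ y → T (boundaryWitness G (ι a) (ι y))) ⊎ (∃ λ y → T (boundaryWitness G (ι a) (κ y)))
    ⇐ (inj₁ single) = inj₂ (b , from (witness-ιa-κ b) single)
    ⇐ (inj₂ 2≤β) with to (+≤β⇔ A a 2) 2≤β
    ... | y , 2≤βpair = inj₁ (y , from (witness-ιa-ι y) 2≤βpair)

  isBoundary-ιa-β≢1 : β A a ≢ + 1 → isBoundary G (ι a) ≡ isBoundary A a
  isBoundary-ιa-β≢1 β≢1 = T-ext (from (T-isBoundary⇔ A a) ∘ Sum.map₂ 2≤⇒1≤ ∘ to T-isBoundary-ιa⇔)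
                                (from T-isBoundary-ιa⇔ ∘ Sum.map₂ 1≤⇒2≤ ∘ to (T-isBoundary⇔ A a))
    where
    2≤⇒1≤ : + 2 ℤ.≤ β A a → + 1 ℤ.≤ β A a
    2≤⇒1≤ = ℤₚ.≤-trans (ℤ.+≤+ (s≤s z≤n))
    1≤⇒2≤ : + 1 ℤ.≤ β A a → + 2 ℤ.≤ β A a
    1≤⇒2≤ 1≤β = ℤₚ.i<j⇒suc[i]≤j (ℤₚ.≤∧≢⇒< 1≤β (β≢1 ∘ ≡.sym))

  isBoundary-ιa-β≡1 : β A a ≡ + 1 → isBoundary G (ι a) ≡ false
  isBoundary-ιa-β≡1 β≡1 = ¬T⇒≡false (excluded ∘ to T-isBoundary-ιa⇔)
    where
    excluded : ¬ (size A ≡ 1 ⊎ + 2 ℤ.≤ β A a)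
    excluded (inj₁ single) with trans (≡.sym (β-isolated A a (from isolated⇔size≡1 single))) β≡1
    ... | ()
    excluded (inj₂ 2≤β) = ℕ.<-irrefl refl (ℤₚ.drop‿+≤+ (subst (+ 2 ℤ.≤_) β≡1 2≤β))

  isBoundary-ι-β≢1 : β A a ≢ + 1 → ∀ x → isBoundary G (ι x) ≡ isBoundary A x
  isBoundary-ι-β≢1 β≢1 x with x Fin.≟ a
  ... | yes refl = isBoundary-ιa-β≢1 β≢1
  ... | no x≢a   = isBoundary-ι-≢ x≢a

  isBoundary-ι-β≡1 : β A a ≡ + 1 → ∀ x → isBoundary G (ι x) ≡ isBoundary A x ∧ not (eqF x a)
  isBoundary-ι-β≡1 β≡1 x with x Fin.≟ a
  ... | yes refl rewrite eqF-refl x = trans (isBoundary-ιa-β≡1 β≡1) (≡.sym (Bool.∧-zeroʳ _))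
  ... | no x≢a   rewrite eqF-≢ x≢a  = trans (isBoundary-ι-≢ x≢a) (≡.sym (Bool.∧-identityʳ _))

  boundary-ι : ∃ λ x → T (isBoundary G (ι x))
  boundary-ι with size A ℕ.≟ 1
  ... | yes single = a , from T-isBoundary-ιa⇔ (inj₁ single)
  ... | no size≢1  with witnessed-by-a size≢1
  ...   | x , x≢a , witness = x , subst T (≡.sym (isBoundary-ι-≢ x≢a))
                                       (from (T-isBoundary⇔∃witness A x size≢1) (a , witness))

  side : Subset (size A)
  side = tabulate (isBoundary G ∘ ι)

  side≡∂─removed : side ≡ ∂ A ─ removed A a
  side≡∂─removed with β A a ℤ.≟ + 1
  ... | yes β≡1 = trans (Vec.tabulate-cong (isBoundary-ι-β≡1 β≡1)) (≡.sym (tabulate-─-⁅⁆ (isBoundary A) a))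
  ... | no  β≢1 = trans (Vec.tabulate-cong (isBoundary-ι-β≢1 β≢1)) (≡.sym (Subset.p─⊥≡p (∂ A)))

  1≤∣side∣ : 1 ≤ ∣ side ∣
  1≤∣side∣ = ∈⇒1≤∣p∣ (∈-tabulate⁺ (isBoundary G ∘ ι) (proj₂ boundary-ι))

  ∣∂∣≤∣side∣+1 : ∣ ∂ A ∣ ≤ ∣ side ∣ + 1
  ∣∂∣≤∣side∣+1 = begin
    ∣ ∂ A ∣                                   ≤⟨ ∣p∣≤∣p─q∣+∣q∣ (∂ A) (removed A a) ⟩
    ∣ ∂ A ─ removed A a ∣ + ∣ removed A a ∣   ≤⟨ ℕ.+-monoʳ-≤ _ (∣removed∣≤1 A a) ⟩
    ∣ ∂ A ─ removed A a ∣ + 1                 ≡⟨ cong (λ s → ∣ s ∣ + 1) (≡.sym side≡∂─removed) ⟩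
    ∣ side ∣ + 1                              ∎
    where open ℕ.≤-Reasoning

join-Join : ∀ G₁ G₂ v₁ v₂ → Join (join G₁ G₂ v₁ v₂) G₁ G₂ v₁ v₂
join-Join G₁ G₂ v₁ v₂ = record
  { ι            = _↑ˡ n₂
  ; κ            = n₁ ↑ʳ_
  ; ι-injective  = Fin.↑ˡ-injective n₂ _ _
  ; κ-injective  = Fin.↑ʳ-injective n₁ _ _
  ; ι≢κ          = ι≢κ
  ; cover        = cover
  ; adj-ιι       = λ x y → cong₂ (joinAdj′ G₁ G₂ v₁ v₂) (Fin.splitAt-↑ˡ n₁ x n₂) (Fin.splitAt-↑ˡ n₁ y n₂)
  ; adj-κκ       = λ x y → cong₂ (joinAdj′ G₁ G₂ v₁ v₂) (Fin.splitAt-↑ʳ n₁ n₂ x) (Fin.splitAt-↑ʳ n₁ n₂ y)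
  ; adj-ικ       = λ x y → cong₂ (joinAdj′ G₁ G₂ v₁ v₂) (Fin.splitAt-↑ˡ n₁ x n₂) (Fin.splitAt-↑ʳ n₁ n₂ y)
  ; sumFin-split = sumFin-↑ n₁ n₂
  }
  where
  n₁ n₂ : ℕ
  n₁ = size G₁
  n₂ = size G₂
  ι≢κ : ∀ x y → x ↑ˡ n₂ ≢ n₁ ↑ʳ y
  ι≢κ x y eq with trans (≡.sym (Fin.splitAt-↑ˡ n₁ x n₂))
                        (trans (cong (Data.Fin.splitAt n₁) eq) (Fin.splitAt-↑ʳ n₁ n₂ y))
  ... | ()
  cover : ∀ z → (∃ λ x → x ↑ˡ n₂ ≡ z) ⊎ (∃ λ y → n₁ ↑ʳ y ≡ z)
  cover z with Data.Fin.splitAt n₁ z in eq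
  ... | inj₁ x = inj₁ (x , Fin.splitAt⁻¹-↑ˡ eq)
  ... | inj₂ y = inj₂ (y , Fin.splitAt⁻¹-↑ʳ eq)

module JoinedBoundary (G₁ G₂ : Graph) (c₁ : Connected G₁) (c₂ : Connected G₂) (v₁ : V G₁) (v₂ : V G₂) where
  G : Graph
  G = join G₁ G₂ v₁ v₂
  J : Join G G₁ G₂ v₁ v₂
  J = join-Join G₁ G₂ v₁ v₂
  ∂∪ : Subset (size G)
  ∂∪ = embedˡ (size G₂) (∂ G₁) ∪ embedʳ (size G₁) (∂ G₂)

  module L = JoinBoundary J c₁ c₂
  module R = JoinBoundary (swap J) c₂ c₁

  ∂-join≡++ : ∂ G ≡ L.side ++ R.side
  ∂-join≡++ = tabulate-↑ (size G₁) (size G₂) (isBoundary G)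

  ∂-join≡ : ∀ {D₁ D₂ D} → removed G₁ v₁ ≡ D₁ → removed G₂ v₂ ≡ D₂ → D₁ ++ D₂ ≡ D → ∂ G ≡ ∂∪ ─ D
  ∂-join≡ {D₁} {D₂} {D} r₁ r₂ D₁++D₂ = begin
    ∂ G                                  ≡⟨ ∂-join≡++ ⟩
    L.side ++ R.side                     ≡⟨ cong₂ _++_ (trans L.side≡∂─removed (cong (∂ G₁ ─_) r₁))
                                                       (trans R.side≡∂─removed (cong (∂ G₂ ─_) r₂)) ⟩
    (∂ G₁ ─ D₁) ++ (∂ G₂ ─ D₂)           ≡⟨ ≡.sym (Vec.zipWith-++ _ (∂ G₁) (∂ G₂) D₁ D₂) ⟩
    (∂ G₁ ++ ∂ G₂) ─ (D₁ ++ D₂)          ≡⟨ cong₂ _─_ (≡.sym (++⊥∪⊥++ (∂ G₁) (∂ G₂))) D₁++D₂ ⟩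
    ∂∪ ─ D                               ∎
    where open ≡-Reasoning

  ∣∂∣≤∣∂-join∣ : ∣ ∂ G₁ ∣ ⊔ ∣ ∂ G₂ ∣ ≤ ∣ ∂ G ∣
  ∣∂∣≤∣∂-join∣ = ℕ.⊔-lub
    (subst (∣ ∂ G₁ ∣ ≤_) (≡.sym ∣∂G∣) (one-side L.∣∂∣≤∣side∣+1 R.1≤∣side∣))
    (subst (∣ ∂ G₂ ∣ ≤_) (≡.sym (trans ∣∂G∣ (ℕ.+-comm ∣ L.side ∣ ∣ R.side ∣)))
                        (one-side R.∣∂∣≤∣side∣+1 L.1≤∣side∣))
    where
    ∣∂G∣ : ∣ ∂ G ∣ ≡ ∣ L.side ∣ + ∣ R.side ∣
    ∣∂G∣ = trans (cong ∣_∣ ∂-join≡++) (∣p++q∣≡∣p∣+∣q∣ L.side R.side)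
    one-side : ∀ {k s t} → k ≤ s + 1 → 1 ≤ t → k ≤ s + t
    one-side {s = s} k≤s+1 1≤t = ℕ.≤-trans k≤s+1 (ℕ.+-monoʳ-≤ s 1≤t)

theorem3p7 : (G₁ G₂ : Graph) → Connected G₁ → Connected G₂ →
    (v₁ : V G₁) (v₂ : V G₂) →
    let n₁ = size G₁
        n₂ = size G₂
        G  = join G₁ G₂ v₁ v₂
        ∂∪ = embedˡ n₂ (∂ G₁) ∪ embedʳ n₁ (∂ G₂)
        w₁ = v₁ ↑ˡ n₂
        w₂ = n₁ ↑ʳ v₂
    in ((β G₁ v₁ ≢ + 1 → β G₂ v₂ ≢ + 1 → ∂ G ≡ ∂∪)
     × (β G₁ v₁ ≡ + 1 → β G₂ v₂ ≢ + 1 → ∂ G ≡ ∂∪ ─ ⁅ w₁ ⁆)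
     × (β G₁ v₁ ≢ + 1 → β G₂ v₂ ≡ + 1 → ∂ G ≡ ∂∪ ─ ⁅ w₂ ⁆)
     × (β G₁ v₁ ≡ + 1 → β G₂ v₂ ≡ + 1 → ∂ G ≡ ∂∪ ─ (⁅ w₁ ⁆ ∪ ⁅ w₂ ⁆)))
     × (∣ ∂ G₁ ∣ ⊔ ∣ ∂ G₂ ∣ ≤ ∣ ∂ G ∣)
theorem3p7 G₁ G₂ c₁ c₂ v₁ v₂ =
  ( (λ h₁ h₂ → trans (∂-join≡ (removed-β≢1 G₁ v₁ h₁) (removed-β≢1 G₂ v₂ h₂) (⊥++⊥ (size G₁) (size G₂)))
                     (Subset.p─⊥≡p ∂∪))
  , (λ h₁ h₂ → ∂-join≡ (removed-β≡1 G₁ v₁ h₁) (removed-β≢1 G₂ v₂ h₂) (≡.sym (⁅↑ˡ⁆ v₁ (size G₂))))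
  , (λ h₁ h₂ → ∂-join≡ (removed-β≢1 G₁ v₁ h₁) (removed-β≡1 G₂ v₂ h₂) (≡.sym (⁅↑ʳ⁆ (size G₁) v₂)))
  , (λ h₁ h₂ → ∂-join≡ (removed-β≡1 G₁ v₁ h₁) (removed-β≡1 G₂ v₂ h₂) (≡.sym (⁅↑ˡ⁆∪⁅↑ʳ⁆ v₁ v₂)))
  ) , ∣∂∣≤∣∂-join∣
  where open JoinedBoundary G₁ G₂ c₁ c₂ v₁ v₂
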